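{- Let $M$ be a model of $\mathsf{ZFA}+\mathsf{AC}$ in which $A$ is an uncountable set of atoms and $\mathcal{G}$ is the group of all permutations of $A$. Let $S$ be the set of all countable partitions of $A$. Then $\mathcal{F}=\{H: H \text{ is a subgroup of } \mathcal{G} \text{ and } H\supseteq \mathrm{fix}_{\mathcal{G}}(P)\text{ for some } P\in S\}$ is a normal filter of subgroups of $\mathcal{G}$.
   Context: For a set $x$, $\mathrm{fix}_{\mathcal{G}}(x)=\{\phi\in\mathcal{G}:\forall y\in x\ \phi(y)=y\}$ (so for a partition $P$, this is the set of permutations mapping each block of $P$ onto itself). A set $\mathcal{F}$ of subgroups of $\mathcal{G}$ is a normal filter if: $\mathcal{G}\in\mathcal{F}$; if $H\in\mathcal{F}$ and $H\subseteq K$ with $K$ a subgroup then $K\in\mathcal{F}$; if $H,K\in\mathcal{F}$ then $H\cap K\in\mathcal{F}$; if $\pi\in\mathcal{G}$ and $H\in\mathcal{F}$ then $\pi H\pi^{ -1}\in\mathcal{F}$; and for each $a\in A$, $\{\pi\in\mathcal{G}:\pi(a)=a\}\in\mathcal{F}$. -}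

module Defs where

open import Level using (Level; suc; _⊔_)
open import Data.Nat using (ℕ)
open import Data.Product using (Σ; ∃; _×_; _,_)
open import Relation.Binary.PropositionalEquality using (_≡_)
open import Relation.Nullary using (¬_)
open import Function using (_∘_)
open import Function.Bundles using (_↔_; _↣_; _⇔_; Inverse)

Countable : ∀ {ℓ} → Set ℓ → Set ℓ
Countable X = X ↣ ℕ

Uncountable : ∀ {ℓ} → Set ℓ → Set ℓ
Uncountable X = ¬ Countable X

Perm : ∀ {ℓ} → Set ℓ → Set ℓ
Perm A = A ↔ A

module _ {ℓ} {A : Set ℓ} where

  app : Perm A → A → A
  app φ = Inverse.to φ

  app⁻¹ : Perm A → A → A
  app⁻¹ φ = Inverse.from φ

  _≈ₚ_ : Perm A → Perm A → Set ℓ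
  φ ≈ₚ ψ = ∀ x → app φ x ≡ app ψ x

  record Subgroup : Set (suc ℓ) where
    field
      mem      : Perm A → Set ℓ
      resp     : ∀ {φ ψ} → φ ≈ₚ ψ → mem φ → mem ψ
      has-id   : ∀ {φ} → (∀ x → app φ x ≡ x) → mem φ
      has-comp : ∀ {φ ψ χ} → (∀ x → app χ x ≡ app φ (app ψ x)) → mem φ → mem ψ → mem χ
      has-inv  : ∀ {φ ψ} → (∀ x → app ψ x ≡ app⁻¹ φ x) → mem φ → mem ψ
  open Subgroup public

  _⊆ₛ_ : Subgroup → Subgroup → Set ℓ
  H ⊆ₛ K = ∀ φ → mem H φ → mem K φ

  whole : Subgroup
  whole = record { mem = λ _ → Lift⊤ ; resp = λ _ _ → _ ; has-id = λ _ → _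
                 ; has-comp = λ _ _ _ → _ ; has-inv = λ _ _ → _ }
    where open import Data.Unit.Polymorphic using () renaming (⊤ to Lift⊤)

  _∩ₛ_ : Subgroup → Subgroup → Subgroup
  H ∩ₛ K = record
    { mem = λ φ → mem H φ × mem K φ
    ; resp = λ e (h , k) → resp H e h , resp K e k
    ; has-id = λ e → has-id H e , has-id K e
    ; has-comp = λ e (h , k) (h' , k') → has-comp H e h h' , has-comp K e k k'
    ; has-inv = λ e (h , k) → has-inv H e h , has-inv K e k }

  -- conjugate π H π⁻¹ = { ψ : π⁻¹ ∘ ψ ∘ π ∈ H } (membership up to ≈ₚ)
  conj : Perm A → Subgroup → Subgroup
  conj π H = record
    { mem = λ ψ → ∀ χ → (∀ x → app χ x ≡ app⁻¹ π (app ψ (app π x))) → mem H χ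
    ; resp = λ {φ} {ψ} e m χ eχ → m χ (λ x → trans (eχ x) (cong (app⁻¹ π) (sym (e (app π x)))))
    ; has-id = λ {φ} e χ eχ → has-id H (λ x → trans (eχ x)
                 (trans (cong (app⁻¹ π) (e (app π x))) (Inverse.strictlyInverseʳ π x)))
    ; has-comp = λ {φ} {ψ} {χ} e mφ mψ ξ eξ →
        has-comp H {φ = ρ φ} {ψ = ρ ψ}
          (λ x → trans (eξ x) (trans (cong (app⁻¹ π) (e (app π x)))
                 (cong (λ y → app⁻¹ π (app φ y)) (sym (Inverse.strictlyInverseˡ π (app ψ (app π x)))))))
          (mφ (ρ φ) (λ _ → refl)) (mψ (ρ ψ) (λ _ → refl))
    ; has-inv = λ {φ} {ψ} e mφ ξ eξ →
        has-inv H {φ = ρ φ}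
          (λ x → trans (eξ x) (cong (app⁻¹ π) (e (app π x))))
          (mφ (ρ φ) (λ _ → refl))
    }
    where
      open import Relation.Binary.PropositionalEquality using (refl; sym; trans; cong)
      import Function.Construct.Composition as Comp
      import Function.Construct.Symmetry as Sym
      -- ρ φ = π⁻¹ ∘ φ ∘ π as a permutation
      ρ : Perm A → Perm A
      ρ φ = Comp.inverse π (Comp.inverse φ (Sym.inverse π))

  Stab : A → Subgroup
  Stab a = record
    { mem = λ φ → app φ a ≡ a
    ; resp = λ e m → trans (sym (e a)) m
    ; has-id = λ e → e a
    ; has-comp = λ {φ} {ψ} e mφ mψ → trans (e a) (trans (cong (app φ) mψ) mφ)
    ; has-inv = λ {φ} e mφ → trans (e a) (trans (cong (app⁻¹ φ) (sym mφ)) (Inverse.strictlyInverseʳ φ a))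
    }
    where open import Relation.Binary.PropositionalEquality using (refl; sym; trans; cong)

  -- A partition of A into blocks indexed by I (distinct indices = distinct blocks):
  -- blocks are nonempty, pairwise disjoint, and cover A.
  record Partition : Set (suc ℓ) where
    field
      Idx      : Set ℓ
      Block    : Idx → A → Set ℓ
      nonempty : ∀ i → ∃ (Block i)
      disjoint : ∀ i j x → Block i x → Block j x → i ≡ j
      cover    : ∀ x → ∃ λ i → Block i x
  open Partition public

  CountablePartition : Set (suc ℓ)
  CountablePartition = Σ Partition λ P → Countable (Idx P)

  -- fix𝒢(P): permutations mapping each block of P onto itself, i.e. φ[B] = B,
  -- i.e. for all x, x ∈ B ⇔ φ(x) ∈ B.
  fix : Partition → Perm A → Set ℓ
  fix P φ = ∀ i x → Block P i x ⇔ Block P i (app φ x)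

  𝓕 : Subgroup → Set (suc ℓ)
  𝓕 H = Σ CountablePartition λ (P , _) → ∀ φ → fix P φ → mem H φ

  record IsNormalFilter (F : Subgroup → Set (suc ℓ)) : Set (suc ℓ) where
    field
      whole∈   : F whole
      upward   : ∀ H K → F H → H ⊆ₛ K → F K
      ∩∈       : ∀ H K → F H → F K → F (H ∩ₛ K)
      conj∈    : ∀ π H → F H → F (conj π H)
      stab∈    : ∀ a → F (Stab a)

-- A subgroup lies in 𝓕 when it contains fix P for a countable partition P, and fix
-- reverses refinement. So each closure property comes from a suitable countable
-- partition: the one-block partition (𝒢 itself), the common refinement P ∧ Q, whose
-- blocks are indexed by a subset of Idx P × Idx Q (H ∩ K), the image π[P], for which
-- fix π[P] = π fix P π⁻¹ (conjugates), and {a} ∪ (A ∖ {a}) (stabilisers). Uncountability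
-- of A is used only to make the blocks of the first and last partition nonempty.
module Submission where

open import Defs
open import Axiom.ExcludedMiddle using (ExcludedMiddle)
open import Axiom.DoubleNegationElimination using (DoubleNegationElimination; em⇒dne)
open import Level using (Lift; lift; lower)
open import Data.Bool using (Bool; true; false)
open import Data.Bool.Properties using (T-irrelevant)
open import Data.Nat using (ℕ; zero; suc; _+_)
open import Data.Nat.Properties using (+-suc; +-identityʳ)
open import Data.Product using (Σ; ∃; _×_; _,_; proj₁; proj₂)
open import Data.Unit.Polymorphic using (⊤; tt)
open import Function using (_∘_)
open import Function.Bundles using (_↣_; _⇔_; Inverse; Injection; Equivalence; mk↣; mk⇔)
open import Function.Construct.Composition using (_↣-∘_)
import Function.Properties.Equivalence as ⇔
open import Relation.Binary.PropositionalEquality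
open import Relation.Nullary using (¬_; Dec; yes; no; does; contradiction)
open import Relation.Nullary.Decidable using (True; toWitness; fromWitness; dec-true; dec-false)
open import Relation.Nullary.Negation using (¬∃⟶∀¬)
import Relation.Unary as U

-- Cantor pairing, with ℕ × ℕ enumerated along the antidiagonals a + b = s

nextOnDiagonal : ℕ × ℕ → ℕ × ℕ
nextOnDiagonal (zero  , b) = suc b , zero
nextOnDiagonal (suc a , b) = a , suc b

unpair : ℕ → ℕ × ℕ
unpair zero    = zero , zero
unpair (suc n) = nextOnDiagonal (unpair n)

-- position of (s ∸ b , b) in the enumeration
diagonalIndex : ℕ → ℕ → ℕ
diagonalIndex s       (suc b) = suc (diagonalIndex s b)
diagonalIndex zero    zero    = zero
diagonalIndex (suc s) zero    = suc (diagonalIndex s s)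

unpair-diagonalIndex : ∀ s b a → a + b ≡ s → unpair (diagonalIndex s b) ≡ (a , b)
unpair-diagonalIndex zero zero a a+0≡0 = cong (_, zero) (trans (sym a+0≡0) (+-identityʳ a))
unpair-diagonalIndex (suc s) zero a a+0≡s+1
  rewrite unpair-diagonalIndex s s zero refl = cong (_, zero) (trans (sym a+0≡s+1) (+-identityʳ a))
unpair-diagonalIndex s (suc b) a a+b+1≡s
  rewrite unpair-diagonalIndex s b (suc a) (trans (sym (+-suc a b)) a+b+1≡s) = refl

pair : ℕ × ℕ → ℕ
pair (a , b) = diagonalIndex (a + b) b

unpair∘pair : ∀ p → unpair (pair p) ≡ p
unpair∘pair (a , b) = unpair-diagonalIndex (a + b) b a refl

pair-↣ : (ℕ × ℕ) ↣ ℕ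
pair-↣ = mk↣ {to = pair} λ {p} {q} eq →
  trans (sym (unpair∘pair p)) (trans (cong unpair eq) (unpair∘pair q))

module _ {a b} {X : Set a} {Y : Set b} where

  Countable-× : Countable X → Countable Y → Countable (X × Y)
  Countable-× f g = pair-↣ ↣-∘ mk↣ {to = λ (x , y) → (to f x , to g y)} λ eq →
    cong₂ _,_ (injective f (cong proj₁ eq)) (injective g (cong proj₂ eq))
    where open Injection using (to; injective)

module _ {a p} {X : Set a} {P : X → Set p} where

  Σ-proj₁-↣ : U.Irrelevant P → Σ X P ↣ X
  Σ-proj₁-↣ irr = mk↣ {to = proj₁} λ { {x , px} {.x , qx} refl → cong (x ,_) (irr px qx) }

Countable-Lift : ∀ {a} ℓ {X : Set a} → Countable X → Countable (Lift ℓ X)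
Countable-Lift ℓ f = f ↣-∘ mk↣ {to = lower} (cong lift)

Countable-Bool : Countable Bool
Countable-Bool = mk↣ {to = toℕ} toℕ-injective
  where
    toℕ : Bool → ℕ
    toℕ false = 0
    toℕ true  = 1
    toℕ-injective : ∀ {b c} → toℕ b ≡ toℕ c → b ≡ c
    toℕ-injective {false} {false} _ = refl
    toℕ-injective {true}  {true}  _ = refl

Countable-⊤ : ∀ {ℓ} → Countable (⊤ {ℓ})
Countable-⊤ = mk↣ {to = λ _ → 0} λ _ → refl

module _ {ℓ} {X : Set ℓ} where

  Uncountable⇒¬¬inhabited : Uncountable X → ¬ ¬ X
  Uncountable⇒¬¬inhabited unc ¬x = unc (mk↣ {to = λ x → 0} λ {x} _ → contradiction x ¬x)

  Uncountable⇒¬∀≡ : Uncountable X → ∀ a → ¬ (∀ x → x ≡ a)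
  Uncountable⇒¬∀≡ unc a all≡a = unc (mk↣ {to = λ _ → 0} λ {x} {y} _ → trans (all≡a x) (sym (all≡a y)))

  module _ (dne : DoubleNegationElimination ℓ) (unc : Uncountable X) where

    Uncountable⇒inhabited : X
    Uncountable⇒inhabited = dne (Uncountable⇒¬¬inhabited unc)

    Uncountable⇒∃≢ : ∀ a → ∃ λ b → ¬ b ≡ a
    Uncountable⇒∃≢ a = dne λ ¬∃≢ → Uncountable⇒¬∀≡ unc a λ x → dne (¬∃⟶∀¬ ¬∃≢ x)

module _ {ℓ} {A : Set ℓ} where

  Block-cong : (P : Partition {A = A}) {i : Idx P} {x y : A} → x ≡ y → Block P i x ⇔ Block P i y
  Block-cong P x≡y = mk⇔ (subst _ x≡y) (subst _ (sym x≡y))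

  Block-⇔-shared : (P : Partition {A = A}) {i j : Idx P} {x y : A} →
                   Block P j x → Block P j y → Block P i x ⇔ Block P i y
  Block-⇔-shared P {j = j} {x} {y} jx jy = mk⇔
    (λ ix → subst (λ k → Block P k y) (disjoint P j _ x jx ix) jy)
    (λ iy → subst (λ k → Block P k x) (disjoint P j _ y jy iy) jx)

  _Refines_ : Partition {A = A} → Partition {A = A} → Set ℓ
  R Refines P = ∀ k → ∃ λ i → ∀ x → Block R k x → Block P i x

  -- x and φ x share the block of R containing x, hence also the block of P containing it.
  fix-antitone : ∀ {R P} → R Refines P → ∀ φ → fix R φ → fix P φ
  fix-antitone {R} {P} R≤P φ fixR i x =
    let (k , xk) = cover R x
        (j , k⊆j) = R≤P k
    in Block-⇔-shared P (k⊆j x xk) (k⊆j (app φ x) (Equivalence.to (fixR k x) xk))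

  fibres : {I : Set ℓ} (f : A → I) → (∀ i → ∃ λ x → f x ≡ i) → Partition {A = A}
  fibres {I} f surjective = record
    { Idx      = I
    ; Block    = λ i x → f x ≡ i
    ; nonempty = surjective
    ; disjoint = λ _ _ _ fx≡i fx≡j → trans (sym fx≡i) fx≡j
    ; cover    = λ x → f x , refl
    }

  Overlap : (P Q : Partition {A = A}) → Idx P → Idx Q → Set ℓ
  Overlap P Q i j = ∃ λ x → Block P i x × Block Q j x

  -- Blocks are indexed by the overlapping pairs; recording the overlap as True of its
  -- decision makes it proof-irrelevant, so that distinct indices give distinct blocks.
  meet : (P Q : Partition {A = A}) → (∀ i j → Dec (Overlap P Q i j)) → Partition {A = A}
  meet P Q overlap? = record
    { Idx      = Σ (Idx P × Idx Q) λ (i , j) → True (overlap? i j)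
    ; Block    = λ ((i , j) , _) x → Block P i x × Block Q j x
    ; nonempty = λ (_ , overlaps) → toWitness overlaps
    ; disjoint = λ _ _ x (xi , xj) (xi′ , xj′) → Injection.injective (Σ-proj₁-↣ T-irrelevant)
                   (cong₂ _,_ (disjoint P _ _ x xi xi′) (disjoint Q _ _ x xj xj′))
    ; cover    = λ x → let (i , xi) = cover P x ; (j , xj) = cover Q x in
                   ((i , j) , fromWitness (x , xi , xj)) , xi , xj
    }

  module _ (P Q : Partition {A = A}) (overlap? : ∀ i j → Dec (Overlap P Q i j)) where

    meet-refinesˡ : meet P Q overlap? Refines P
    meet-refinesˡ ((i , _) , _) = i , λ _ → proj₁

    meet-refinesʳ : meet P Q overlap? Refines Q
    meet-refinesʳ ((_ , j) , _) = j , λ _ → proj₂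

    fix-meet : ∀ φ → fix (meet P Q overlap?) φ → fix P φ × fix Q φ
    fix-meet φ fixφ = fix-antitone {meet P Q overlap?} {P} meet-refinesˡ φ fixφ ,
                      fix-antitone {meet P Q overlap?} {Q} meet-refinesʳ φ fixφ

    Countable-meet : Countable (Idx P) → Countable (Idx Q) → Countable (Idx (meet P Q overlap?))
    Countable-meet cP cQ = Countable-× cP cQ ↣-∘ Σ-proj₁-↣ T-irrelevant

  image : Perm A → Partition {A = A} → Partition {A = A}
  image π P = record
    { Idx      = Idx P
    ; Block    = λ i x → Block P i (app⁻¹ π x)
    ; nonempty = λ i → let (x , xi) = nonempty P i in
                   app π x , Equivalence.to (Block-cong P (sym (Inverse.strictlyInverseʳ π x))) xi
    ; disjoint = λ i j x → disjoint P i j (app⁻¹ π x)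
    ; cover    = λ x → cover P (app⁻¹ π x)
    }

  fix-image : ∀ π P ψ χ → (∀ x → app χ x ≡ app⁻¹ π (app ψ (app π x))) →
              fix (image π P) ψ → fix P χ
  fix-image π P ψ χ χ≈π⁻¹ψπ fixψ i x = begin
    Block P i x                             ≈⟨ Block-cong P (sym (Inverse.strictlyInverseʳ π x)) ⟩
    Block P i (app⁻¹ π (app π x))           ≈⟨ fixψ i (app π x) ⟩
    Block P i (app⁻¹ π (app ψ (app π x)))   ≈⟨ Block-cong P (sym (χ≈π⁻¹ψπ x)) ⟩
    Block P i (app χ x)                     ∎
    where open import Relation.Binary.Reasoning.Setoid (⇔.⇔-setoid ℓ)

  module _ (a : A) (_≟a : ∀ x → Dec (x ≡ a)) where

    indicator : A → Lift ℓ Bool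
    indicator x = lift (does (x ≟a))

    singletonPartition : (∃ λ b → ¬ b ≡ a) → Partition {A = A}
    singletonPartition (b , b≢a) = fibres indicator λ where
      (lift true)  → a , cong lift (dec-true (a ≟a) refl)
      (lift false) → b , cong lift (dec-false (b ≟a) b≢a)

    fix-singletonPartition⇒Stab : ∀ b≢a φ → fix (singletonPartition b≢a) φ → app φ a ≡ a
    fix-singletonPartition⇒Stab _ φ fixφ =
      indicator≡true⇒≡ (app φ a) (Equivalence.to (fixφ (lift true) a) (cong lift (dec-true (a ≟a) refl)))
      where
        indicator≡true⇒≡ : ∀ x → indicator x ≡ lift true → x ≡ a
        indicator≡true⇒≡ x _ with x ≟a
        indicator≡true⇒≡ x _  | yes x≡a = x≡a
        indicator≡true⇒≡ x () | no _

lemma4p6 : ∀ {ℓ} (A : Set ℓ) → ExcludedMiddle ℓ → Uncountable A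
    → IsNormalFilter {A = A} 𝓕
lemma4p6 {ℓ} A em unc = record
  { whole∈ = (fibres (λ _ → tt) (λ _ → inhabitant , refl) , Countable-⊤) , λ _ _ → tt
  ; upward = λ H K (P , P⊆H) H⊆K → P , λ φ → H⊆K φ ∘ P⊆H φ
  ; ∩∈     = λ H K ((P , cP) , P⊆H) ((Q , cQ) , Q⊆K) →
               (meet P Q (overlap? P Q) , Countable-meet P Q (overlap? P Q) cP cQ) , λ φ fixφ →
                 let (fixP , fixQ) = fix-meet P Q (overlap? P Q) φ fixφ in P⊆H φ fixP , Q⊆K φ fixQ
  ; conj∈  = λ π H ((P , cP) , P⊆H) →
               (image π P , cP) , λ ψ fixψ χ χ≈π⁻¹ψπ → P⊆H χ (fix-image π P ψ χ χ≈π⁻¹ψπ fixψ)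
  ; stab∈  = λ a → (singletonPartition a (_≟ a) (other a) , Countable-Lift ℓ Countable-Bool) ,
               fix-singletonPartition⇒Stab a (_≟ a) (other a)
  }
  where
    overlap? : (P Q : Partition {A = A}) → ∀ i j → Dec (Overlap P Q i j)
    overlap? _ _ _ _ = em
    _≟_ : (x a : A) → Dec (x ≡ a)
    _ ≟ _ = em
    inhabitant : A
    inhabitant = Uncountable⇒inhabited (em⇒dne em) unc
    other : ∀ a → ∃ λ b → ¬ b ≡ a
    other = Uncountable⇒∃≢ (em⇒dne em) unc
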